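{- Let $\Phi=(\phi_j)_{j=1}^n$ be a collection of vectors in a non-isotropic space $V$ with $\langle\phi_j,\phi_j\rangle=a$ for all $j$, let $d:=\dim(\operatorname{im}\Phi)$, and suppose $\frac{na}{d}\neq 0$ in $\mathbb{F}$. If $\operatorname{Char}\mathbb{F}>d$ and $(\Phi^\dagger\Phi)^2=\frac{na}{d}\Phi^\dagger\Phi$, then $\operatorname{im}\Phi$ is non-isotropic and $\Phi$ is an $\frac{na}{d}$-tight frame for $\operatorname{im}\Phi$.
   Context: $\mathbb{F}$ is a field with an involution $\sigma$ (possibly the identity). A non-isotropic space is a finite-dimensional $\mathbb{F}$-vector space with a non-degenerate Hermitian scalar product $\langle\cdot,\cdot\rangle$ (linear in the second argument, $\langle u,v\rangle=\langle v,u\rangle^\sigma$, non-degenerate); a subspace is non-isotropic if the restricted form is non-degenerate. $\mathbb{F}^n$ carries $\langle x,y\rangle=\sum_ix_i^\sigma y_i$. The synthesis operator of $\Phi$ is $\Phi:\mathbb{F}^n\to V$, $x\mapsto\sum_jx_j\phi_j$, with adjoint $\Phi^\dagger v=(\langle\phi_j,v\rangle)_j$, so $\Phi^\dagger\Phi=[\langle\phi_j,\phi_k\rangle]_{j,k}$. $\Phi$ is a $c$-tight frame for a non-isotropic subspace $U$ if its vectors span $U$ and $\Phi\Phi^\dagger u=cu$ for all $u\in U$. Integers and fractions are interpreted in $\mathbb{F}$ via $\mathbb{Z}\to\mathbb{F}$. -}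

module Defs where

open import Level using (_⊔_; suc)
open import Data.Nat using (ℕ; _≤_; _<_)
open import Data.Fin using (Fin)
open import Data.Product using (Σ; ∃; _×_)
open import Relation.Nullary using (¬_)
open import Algebra.Bundles using (CommutativeRing)
import Algebra.Definitions.RawMonoid as RawMonoidDefs

-- A field with an involution σ (σ may be the identity).
-- Equality is the setoid equality _≈_ of the underlying commutative ring.

record InvolutiveField (c ℓ : Level.Level) : Set (Level.suc (c ⊔ ℓ)) where
  field
    commutativeRing : CommutativeRing c ℓ
  open CommutativeRing commutativeRing public
  field
    1≉0     : ¬ (1# ≈ 0#)
    inverse : ∀ x → ¬ (x ≈ 0#) → ∃ λ y → x * y ≈ 1#
    σ       : Carrier → Carrier
    σ-cong  : ∀ {x y} → x ≈ y → σ x ≈ σ y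
    σ-+     : ∀ x y → σ (x + y) ≈ σ x + σ y
    σ-*     : ∀ x y → σ (x * y) ≈ σ x * σ y
    σ-1     : σ 1# ≈ 1#
    σ-invol : ∀ x → σ (σ x) ≈ x

module FieldTheory {c ℓ} (F : InvolutiveField c ℓ) where
  open InvolutiveField F public

  open RawMonoidDefs +-rawMonoid public using (sum) renaming (_×_ to _·ℕ_)

  ι : ℕ → Carrier
  ι k = k ·ℕ 1#

  -- Char F > d : no k with 1 ≤ k ≤ d has k·1 = 0 in F
  -- (characteristic 0 counts as larger than every d).
  CharGreaterThan : ℕ → Set ℓ
  CharGreaterThan d = ∀ k → 1 ≤ k → k ≤ d → ¬ (ι k ≈ 0#)

  Vec : ℕ → Set c
  Vec m = Fin m → Carrier

  _≋_ : ∀ {m} → Vec m → Vec m → Set ℓ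
  u ≋ v = ∀ i → u i ≈ v i

  _⊕_ : ∀ {m} → Vec m → Vec m → Vec m
  (u ⊕ v) i = u i + v i

  _⊙_ : ∀ {m} → Carrier → Vec m → Vec m
  (a ⊙ v) i = a * v i

  0ᵥ : ∀ {m} → Vec m
  0ᵥ i = 0#

  lincomb : ∀ {k m} → (Fin k → Vec m) → Vec k → Vec m
  lincomb ψ x i = sum (λ j → x j * ψ j i)

  -- Every finite-dimensional non-isotropic space is isometric to some
  -- (F^m, B) of this kind.
  record NonIsotropicSpace (m : ℕ) : Set (c ⊔ ℓ) where
    field
      ⟪_,_⟫      : Vec m → Vec m → Carrier
      form-cong  : ∀ {u u' v v'} → u ≋ u' → v ≋ v' → ⟪ u , v ⟫ ≈ ⟪ u' , v' ⟫
      additiveʳ  : ∀ u v w → ⟪ u , v ⊕ w ⟫ ≈ ⟪ u , v ⟫ + ⟪ u , w ⟫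
      homogeneousʳ : ∀ u a v → ⟪ u , a ⊙ v ⟫ ≈ a * ⟪ u , v ⟫
      hermitian  : ∀ u v → ⟪ u , v ⟫ ≈ σ ⟪ v , u ⟫
      nondegenerate : ∀ u → (∀ v → ⟪ u , v ⟫ ≈ 0#) → u ≋ 0ᵥ

  module _ {m : ℕ} (V : NonIsotropicSpace m) where
    open NonIsotropicSpace V

    Subspace : Set (Level.suc (c ⊔ ℓ))
    Subspace = Vec m → Set (c ⊔ ℓ)

    IsNonIsotropic : Subspace → Set (c ⊔ ℓ)
    IsNonIsotropic U = ∀ u → U u → (∀ w → U w → ⟪ u , w ⟫ ≈ 0#) → u ≋ 0ᵥ

    module _ {n : ℕ} (Φ : Fin n → Vec m) where

      synthesis : Vec n → Vec m
      synthesis = lincomb Φ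

      adjoint : Vec m → Vec n
      adjoint v j = ⟪ Φ j , v ⟫

      gram : Fin n → Fin n → Carrier
      gram j k = ⟪ Φ j , Φ k ⟫

      GramSquareIs : Carrier → Set ℓ
      GramSquareIs c₀ = ∀ j k → sum (λ l → gram j l * gram l k) ≈ c₀ * gram j k

      image : Subspace
      image v = ∃ λ x → synthesis x ≋ v

      HasDimension : ℕ → Set (c ⊔ ℓ)
      HasDimension d =
        Σ (Fin d → Vec m) λ b →
            (∀ i → image (b i))
          × (∀ x → lincomb b x ≋ 0ᵥ → ∀ i → x i ≈ 0#)
          × (∀ v → image v → ∃ λ x → lincomb b x ≋ v)

      Spans : Subspace → Set (c ⊔ ℓ)
      Spans U = (∀ j → U (Φ j)) × (∀ u → U u → ∃ λ x → synthesis x ≋ u)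

      IsTightFrame : Carrier → Subspace → Set (c ⊔ ℓ)
      IsTightFrame c₀ U =
        Spans U × (∀ u → U u → synthesis (adjoint u) ≋ (c₀ ⊙ u))

-- Choose d vectors b_k spanning im Φ, let A hold the coordinates of the φ_j
-- in them and H = [⟨φ_j, b_k⟩]. Then G = Φ†Φ = H Aᵀ, so the d × d matrix
-- K = Aᵀ H satisfies K² = cK and tr K = tr G = na = cd. Hence N = K − cI has
-- N² = −cN and tr N = 0, and as 1, …, d are invertible this forces N = 0:
-- on the fermionic Fock space of F^d, the vacuum expectations of T^m(W), where
-- T(W) = Σ N_ij a_i W a_j⁺, obey a Newton-type recursion whose coefficients are
-- 1, …, d, while any d + 1 creation operators vanish.
-- From K = cI, the coordinates x of a vector of im Φ orthogonal to every φ_j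
-- satisfy c x = Aᵀ H x = 0, so such a vector is 0. This gives non-isotropy, and
-- tightness follows because for u = Φ y the vector ΦΦ†u − cu = Φ(G y − c y) lies
-- in im Φ and is orthogonal to every φ_j, since G² = cG.

module Submission where

open import Defs
open import Level using (Level; _⊔_)
open import Data.Nat as ℕ using (ℕ; zero; suc; _≤_; _<_; s≤s; z≤n)
import Data.Nat.Properties as ℕₚ
open import Data.Fin using (Fin; zero; suc)
open import Data.Product using (_×_; _,_; ∃; proj₁; proj₂)
open import Function using (_∘_; id)
open import Relation.Nullary using (¬_)
open import Relation.Binary.Bundles using (Setoid)
import Relation.Binary.Reasoning.Setoid
open import Relation.Binary.PropositionalEquality as ≡ using (_≡_)
open import Algebra.Bundles using (CommutativeRing)

module RingLemmas {c ℓ} (R : CommutativeRing c ℓ) where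

  open CommutativeRing R hiding (zero)
  open import Algebra.Definitions.RawMonoid +-rawMonoid public
    using (sum) renaming (_×_ to _·ℕ_)
  open import Algebra.Properties.Semiring.Sum semiring public
    using (sum-cong-≋; ∑-distrib-+; ∑-comm; *-distribˡ-sum; *-distribʳ-sum; sum-replicate; sum-replicate-zero)
  open import Algebra.Properties.Semiring.Mult semiring using (×-assoc-*; ×-congʳ)
  open import Algebra.Properties.Ring ring using (-0#≈0#; -‿+-comm; -‿distribˡ-*; -‿distribʳ-*; -‿involutive)
  open import Algebra.Properties.CommutativeSemigroup *-commutativeSemigroup using (interchange)

  ι : ℕ → Carrier
  ι k = k ·ℕ 1#

  ι-* : ∀ k x → ι k * x ≈ k ·ℕ x
  ι-* k x = trans (×-assoc-* k 1# x) (×-congʳ k (*-identityˡ x))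

  -‿distrib-sum : ∀ {n} (f : Fin n → Carrier) → - sum f ≈ sum (λ i → - f i)
  -‿distrib-sum {zero}  f = -0#≈0#
  -‿distrib-sum {suc n} f = trans (sym (-‿+-comm (f zero) _)) (+-congˡ (-‿distrib-sum (f ∘ suc)))

  sum-⊟ : ∀ {n} (f g : Fin n → Carrier) → sum (λ j → f j - g j) ≈ sum f - sum g
  sum-⊟ f g = trans (∑-distrib-+ f (λ j → - g j)) (+-congˡ (sym (-‿distrib-sum g)))

  δ : ∀ {n} → Fin n → Fin n → Carrier
  δ zero    zero    = 1#
  δ zero    (suc _) = 0#
  δ (suc _) zero    = 0#
  δ (suc i) (suc j) = δ i j

  δ-sym : ∀ {n} (i j : Fin n) → δ i j ≡ δ j i
  δ-sym zero    zero    = ≡.refl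
  δ-sym zero    (suc j) = ≡.refl
  δ-sym (suc i) zero    = ≡.refl
  δ-sym (suc i) (suc j) = δ-sym i j

  δ-diag : ∀ {n} (i : Fin n) → δ i i ≡ 1#
  δ-diag zero    = ≡.refl
  δ-diag (suc i) = δ-diag i

  sum-δˡ : ∀ {n} (i : Fin n) (f : Fin n → Carrier) → sum (λ j → δ i j * f j) ≈ f i
  sum-δˡ {suc n} zero f = begin
    1# * f zero + sum (λ j → 0# * f (suc j)) ≈⟨ +-cong (*-identityˡ _) (sum-cong-≋ (λ j → zeroˡ (f (suc j)))) ⟩
    f zero + sum {n} (λ _ → 0#)             ≈⟨ +-congˡ (sum-replicate-zero n) ⟩
    f zero + 0#                             ≈⟨ +-identityʳ _ ⟩
    f zero                                  ∎
    where open import Relation.Binary.Reasoning.Setoid setoid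
  sum-δˡ (suc i) f = trans (+-cong (zeroˡ (f zero)) (sum-δˡ i (f ∘ suc))) (+-identityˡ _)

  sum-δʳ : ∀ {n} (i : Fin n) (f : Fin n → Carrier) → sum (λ j → f j * δ j i) ≈ f i
  sum-δʳ i f = trans (sum-cong-≋ (λ j → trans (*-comm (f j) _) (*-congʳ (reflexive (δ-sym j i))))) (sum-δˡ i f)

  sum-δ-diag : ∀ n → sum (λ (i : Fin n) → δ i i) ≈ ι n
  sum-δ-diag n = trans (sum-cong-≋ {n} {λ i → δ i i} {λ _ → 1#} (reflexive ∘ δ-diag)) (sum-replicate n)

  IsUnit : Carrier → Set (c ⊔ ℓ)
  IsUnit x = ∃ λ y → y * x ≈ 1#

  *-isUnit : ∀ {x y} → IsUnit x → IsUnit y → IsUnit (x * y)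
  *-isUnit {x} {y} (x′ , x′x≈1) (y′ , y′y≈1) =
    x′ * y′ , trans (interchange x′ y′ x y) (trans (*-cong x′x≈1 y′y≈1) (*-identityˡ 1#))

  -‿isUnit : ∀ {x} → IsUnit x → IsUnit (- x)
  -‿isUnit {x} (x′ , x′x≈1) =
    - x′ , trans (sym (-‿distribˡ-* x′ (- x))) (trans (-‿cong (sym (-‿distribʳ-* x′ x))) (trans (-‿involutive _) x′x≈1))

  isUnit-cancelˡ : ∀ {x y} → IsUnit x → x * y ≈ 0# → y ≈ 0#
  isUnit-cancelˡ {x} {y} (x′ , x′x≈1) xy≈0 = begin
    y              ≈⟨ *-identityˡ y ⟨
    1# * y         ≈⟨ *-congʳ x′x≈1 ⟨
    (x′ * x) * y   ≈⟨ *-assoc x′ x y ⟩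
    x′ * (x * y)   ≈⟨ *-congˡ xy≈0 ⟩
    x′ * 0#        ≈⟨ zeroʳ x′ ⟩
    0#             ∎
    where open import Relation.Binary.Reasoning.Setoid setoid

module Matrices {c ℓ} (R : CommutativeRing c ℓ) where

  open CommutativeRing R hiding (zero)
  open RingLemmas R
  open import Algebra.Properties.Ring ring using (x[y-z]≈xy-xz; [y-z]x≈yx-zx; -‿distribˡ-*)
  open import Algebra.Properties.CommutativeSemigroup *-commutativeSemigroup using (x∙yz≈y∙xz)

  Matrix : ℕ → ℕ → Set c
  Matrix p q = Fin p → Fin q → Carrier

  infix  4 _≈ₘ_
  infixl 6 _⊟_
  infixl 7 _·_
  infixr 8 _⊛_

  _≈ₘ_ : ∀ {p q} → Matrix p q → Matrix p q → Set ℓ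
  X ≈ₘ Y = ∀ i j → X i j ≈ Y i j

  ≈ₘ-refl : ∀ {p q} {X : Matrix p q} → X ≈ₘ X
  ≈ₘ-refl _ _ = refl

  ≈ₘ-sym : ∀ {p q} {X Y : Matrix p q} → X ≈ₘ Y → Y ≈ₘ X
  ≈ₘ-sym X≈Y i j = sym (X≈Y i j)

  ≈ₘ-setoid : ℕ → ℕ → Setoid c ℓ
  ≈ₘ-setoid p q = record
    { Carrier       = Matrix p q
    ; _≈_           = _≈ₘ_
    ; isEquivalence = record
      { refl  = ≈ₘ-refl
      ; sym   = ≈ₘ-sym
      ; trans = λ X≈Y Y≈Z i j → trans (X≈Y i j) (Y≈Z i j)
      }
    }

  module ≈ₘ-Reasoning {p q : ℕ} = Relation.Binary.Reasoning.Setoid (≈ₘ-setoid p q)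

  _·_ : ∀ {p q r} → Matrix p q → Matrix q r → Matrix p r
  (X · Y) i k = sum (λ j → X i j * Y j k)

  _ᵀ : ∀ {p q} → Matrix p q → Matrix q p
  (X ᵀ) i j = X j i

  _⊛_ : ∀ {p q} → Carrier → Matrix p q → Matrix p q
  (x ⊛ X) i j = x * X i j

  _⊟_ : ∀ {p q} → Matrix p q → Matrix p q → Matrix p q
  (X ⊟ Y) i j = X i j - Y i j

  0ₘ : ∀ {p q} → Matrix p q
  0ₘ _ _ = 0#

  1ₘ : ∀ {p} → Matrix p p
  1ₘ = δ

  column : ∀ {p} → (Fin p → Carrier) → Matrix p 1
  column v i _ = v i

  trace : ∀ {p} → Matrix p p → Carrier
  trace X = sum (λ i → X i i)

  ·-cong : ∀ {p q r} {X X′ : Matrix p q} {Y Y′ : Matrix q r} → X ≈ₘ X′ → Y ≈ₘ Y′ → X · Y ≈ₘ X′ · Y′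
  ·-cong X≈X′ Y≈Y′ i k = sum-cong-≋ (λ j → *-cong (X≈X′ i j) (Y≈Y′ j k))

  ·-assoc : ∀ {p q r s} (X : Matrix p q) (Y : Matrix q r) (Z : Matrix r s) → (X · Y) · Z ≈ₘ X · (Y · Z)
  ·-assoc X Y Z i l = begin
    sum (λ k → sum (λ j → X i j * Y j k) * Z k l)   ≈⟨ sum-cong-≋ (λ k → *-distribʳ-sum (Z k l) (λ j → X i j * Y j k)) ⟩
    sum (λ k → sum (λ j → X i j * Y j k * Z k l))   ≈⟨ ∑-comm (λ k j → X i j * Y j k * Z k l) ⟩
    sum (λ j → sum (λ k → X i j * Y j k * Z k l))   ≈⟨ sum-cong-≋ (λ j → sum-cong-≋ (λ k → *-assoc (X i j) (Y j k) (Z k l))) ⟩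
    sum (λ j → sum (λ k → X i j * (Y j k * Z k l))) ≈⟨ sum-cong-≋ (λ j → *-distribˡ-sum (X i j) (λ k → Y j k * Z k l)) ⟨
    sum (λ j → X i j * sum (λ k → Y j k * Z k l))   ∎
    where open import Relation.Binary.Reasoning.Setoid setoid

  ·-⊛ : ∀ {p q r} (X : Matrix p q) x (Y : Matrix q r) → X · (x ⊛ Y) ≈ₘ x ⊛ (X · Y)
  ·-⊛ X x Y i k = trans (sum-cong-≋ (λ j → x∙yz≈y∙xz (X i j) x (Y j k))) (sym (*-distribˡ-sum x (λ j → X i j * Y j k)))

  ⊛-· : ∀ {p q r} x (X : Matrix p q) (Y : Matrix q r) → (x ⊛ X) · Y ≈ₘ x ⊛ (X · Y)
  ⊛-· x X Y i k = trans (sum-cong-≋ (λ j → *-assoc x (X i j) (Y j k))) (sym (*-distribˡ-sum x (λ j → X i j * Y j k)))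

  ·-identityˡ : ∀ {p q} (X : Matrix p q) → 1ₘ · X ≈ₘ X
  ·-identityˡ X i k = sum-δˡ i (λ j → X j k)

  ·-identityʳ : ∀ {p q} (X : Matrix p q) → X · 1ₘ ≈ₘ X
  ·-identityʳ X i k = sum-δʳ k (X i)

  ·-zeroʳ : ∀ {p q r} (X : Matrix p q) → X · 0ₘ {q} {r} ≈ₘ 0ₘ
  ·-zeroʳ {q = q} X i k = trans (sum-cong-≋ (λ j → zeroʳ (X i j))) (sum-replicate-zero q)

  ⊟-cong : ∀ {p q} {X X′ Y Y′ : Matrix p q} → X ≈ₘ X′ → Y ≈ₘ Y′ → X ⊟ Y ≈ₘ X′ ⊟ Y′
  ⊟-cong X≈X′ Y≈Y′ i j = +-cong (X≈X′ i j) (-‿cong (Y≈Y′ i j))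

  ⊟-self : ∀ {p q} (X : Matrix p q) → X ⊟ X ≈ₘ 0ₘ
  ⊟-self X i j = -‿inverseʳ (X i j)

  ·-distribˡ-⊟ : ∀ {p q r} (X : Matrix p q) (Y Z : Matrix q r) → X · (Y ⊟ Z) ≈ₘ X · Y ⊟ X · Z
  ·-distribˡ-⊟ X Y Z i k = trans (sum-cong-≋ (λ j → x[y-z]≈xy-xz (X i j) (Y j k) (Z j k)))
    (sum-⊟ (λ j → X i j * Y j k) (λ j → X i j * Z j k))

  ·-distribʳ-⊟ : ∀ {p q r} (X Y : Matrix p q) (Z : Matrix q r) → (X ⊟ Y) · Z ≈ₘ X · Z ⊟ Y · Z
  ·-distribʳ-⊟ X Y Z i k = trans (sum-cong-≋ (λ j → [y-z]x≈yx-zx (Z j k) (X i j) (Y i j)))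
    (sum-⊟ (λ j → X i j * Z j k) (λ j → Y i j * Z j k))

  trace-cong : ∀ {p} {X Y : Matrix p p} → X ≈ₘ Y → trace X ≈ trace Y
  trace-cong X≈Y = sum-cong-≋ (λ i → X≈Y i i)

  trace-comm : ∀ {p q} (X : Matrix p q) (Y : Matrix q p) → trace (X · Y) ≈ trace (Y · X)
  trace-comm X Y = trans (∑-comm (λ i j → X i j * Y j i)) (sum-cong-≋ (λ j → sum-cong-≋ (λ i → *-comm (X i j) (Y j i))))

  trace-⊟ : ∀ {p} (X Y : Matrix p p) → trace (X ⊟ Y) ≈ trace X - trace Y
  trace-⊟ X Y = sum-⊟ (λ i → X i i) (λ i → Y i i)

  trace-⊛ : ∀ {p} x (X : Matrix p p) → trace (x ⊛ X) ≈ x * trace X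
  trace-⊛ x X = sym (*-distribˡ-sum x (λ i → X i i))

  trace-1ₘ : ∀ p → trace (1ₘ {p}) ≈ ι p
  trace-1ₘ = sum-δ-diag

  shift-quasiIdempotent : ∀ {p} (X : Matrix p p) x → X · X ≈ₘ x ⊛ X →
                          (X ⊟ x ⊛ 1ₘ) · (X ⊟ x ⊛ 1ₘ) ≈ₘ (- x) ⊛ (X ⊟ x ⊛ 1ₘ)
  shift-quasiIdempotent {p} X x X²≈xX = begin
    (X ⊟ x ⊛ 1ₘ) · Y         ≈⟨ ·-distribʳ-⊟ X (x ⊛ 1ₘ) Y ⟩
    X · Y ⊟ (x ⊛ 1ₘ) · Y     ≈⟨ ⊟-cong XY≈0 (λ i j → trans (⊛-· x 1ₘ Y i j) (*-congˡ (·-identityˡ Y i j))) ⟩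
    0ₘ ⊟ x ⊛ Y               ≈⟨ (λ i j → trans (+-identityˡ _) (-‿distribˡ-* x (Y i j))) ⟩
    (- x) ⊛ Y                ∎
    where
    open ≈ₘ-Reasoning
    Y : Matrix p p
    Y = X ⊟ x ⊛ 1ₘ
    XY≈0 : X · Y ≈ₘ 0ₘ
    XY≈0 = begin
      X · (X ⊟ x ⊛ 1ₘ)        ≈⟨ ·-distribˡ-⊟ X X (x ⊛ 1ₘ) ⟩
      X · X ⊟ X · (x ⊛ 1ₘ)    ≈⟨ ⊟-cong X²≈xX (λ i j → trans (·-⊛ X x 1ₘ i j) (*-congˡ (·-identityʳ X i j))) ⟩
      x ⊛ X ⊟ x ⊛ X           ≈⟨ ⊟-self (x ⊛ X) ⟩
      0ₘ                      ∎

module FermionicFockSpace {c ℓ} (R : CommutativeRing c ℓ) where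

  open import Data.Bool using (Bool; true; false)
  open import Data.Vec using (Vec; []; _∷_; replicate)
  open CommutativeRing R hiding (zero)
  open import Algebra.Properties.Ring ring using (-0#≈0#; -‿involutive; -‿distribˡ-*; -‿distribʳ-*; -‿+-comm; -1*x≈-x)
  open RingLemmas R

  -- The exterior algebra on d generators: one coefficient for each set of
  -- generators, given by its indicator vector.
  Λ : ℕ → Set c
  Λ d = Vec Bool d → Carrier

  ∅ : ∀ {d} → Vec Bool d
  ∅ = replicate _ false

  infix 4 _≐_
  _≐_ : ∀ {d} → Λ d → Λ d → Set ℓ
  ψ ≐ φ = ∀ t → ψ t ≈ φ t

  data Ladder : Set where
    annihilation creation : Ladder

  -- Jordan–Wigner convention: acting on generator i costs a sign for every
  -- occupied generator before it.
  ladder : ∀ {d} → Ladder → Fin d → Λ d → Λ d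
  ladder k (suc i) ψ (false ∷ t)         = ladder k i (ψ ∘ (false ∷_)) t
  ladder k (suc i) ψ (true ∷ t)          = - ladder k i (ψ ∘ (true ∷_)) t
  ladder annihilation zero ψ (false ∷ t) = ψ (true ∷ t)
  ladder annihilation zero ψ (true ∷ t)  = 0#
  ladder creation zero ψ (false ∷ t)     = 0#
  ladder creation zero ψ (true ∷ t)      = ψ (false ∷ t)

  a a⁺ : ∀ {d} → Fin d → Λ d → Λ d
  a  = ladder annihilation
  a⁺ = ladder creation

  record IsLinear {d} (W : Λ d → Λ d) : Set (c ⊔ ℓ) where
    field
      ≐-cong : ∀ {ψ φ} → ψ ≐ φ → W ψ ≐ W φ
      +-homo : ∀ ψ φ → W (λ u → ψ u + φ u) ≐ λ t → W ψ t + W φ t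
      *-homo : ∀ x ψ → W (λ u → x * ψ u) ≐ λ t → x * W ψ t

    0-homo : W (λ _ → 0#) ≐ λ _ → 0#
    0-homo t = trans (≐-cong (λ _ → sym (zeroˡ 0#)) t) (trans (*-homo 0# (λ _ → 0#) t) (zeroˡ _))

    -‿homo : ∀ ψ → W (λ u → - ψ u) ≐ λ t → - W ψ t
    -‿homo ψ t = trans (≐-cong (λ u → sym (-1*x≈-x (ψ u))) t) (trans (*-homo (- 1#) ψ t) (-1*x≈-x _))

    sum-homo : ∀ {n} (f : Fin n → Λ d) → W (λ u → sum (λ j → f j u)) ≐ λ t → sum (λ j → W (f j) t)
    sum-homo {zero}  f = 0-homo
    sum-homo {suc n} f t = trans (+-homo (f zero) _ t) (+-congˡ (sum-homo (f ∘ suc) t))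

  open IsLinear public

  ladder-cong : ∀ {d} k (i : Fin d) {ψ φ} → ψ ≐ φ → ladder k i ψ ≐ ladder k i φ
  ladder-cong k (suc i) e (false ∷ t)         = ladder-cong k i (e ∘ (false ∷_)) t
  ladder-cong k (suc i) e (true ∷ t)          = -‿cong (ladder-cong k i (e ∘ (true ∷_)) t)
  ladder-cong annihilation zero e (false ∷ t) = e (true ∷ t)
  ladder-cong annihilation zero e (true ∷ t)  = refl
  ladder-cong creation zero e (false ∷ t)     = refl
  ladder-cong creation zero e (true ∷ t)      = e (false ∷ t)

  ladder-+ : ∀ {d} k (i : Fin d) ψ φ → ladder k i (λ u → ψ u + φ u) ≐ λ t → ladder k i ψ t + ladder k i φ t
  ladder-+ k (suc i) ψ φ (false ∷ t)         = ladder-+ k i _ _ t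
  ladder-+ k (suc i) ψ φ (true ∷ t)          = trans (-‿cong (ladder-+ k i _ _ t)) (sym (-‿+-comm _ _))
  ladder-+ annihilation zero ψ φ (false ∷ t) = refl
  ladder-+ annihilation zero ψ φ (true ∷ t)  = sym (+-identityˡ 0#)
  ladder-+ creation zero ψ φ (false ∷ t)     = sym (+-identityˡ 0#)
  ladder-+ creation zero ψ φ (true ∷ t)      = refl

  ladder-* : ∀ {d} k (i : Fin d) x ψ → ladder k i (λ u → x * ψ u) ≐ λ t → x * ladder k i ψ t
  ladder-* k (suc i) x ψ (false ∷ t)         = ladder-* k i x _ t
  ladder-* k (suc i) x ψ (true ∷ t)          = trans (-‿cong (ladder-* k i x _ t)) (-‿distribʳ-* x _)
  ladder-* annihilation zero x ψ (false ∷ t) = refl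
  ladder-* annihilation zero x ψ (true ∷ t)  = sym (zeroʳ x)
  ladder-* creation zero x ψ (false ∷ t)     = sym (zeroʳ x)
  ladder-* creation zero x ψ (true ∷ t)      = refl

  ladder-linear : ∀ {d} k (i : Fin d) → IsLinear (ladder k i)
  ladder-linear k i = record { ≐-cong = ladder-cong k i ; +-homo = ladder-+ k i ; *-homo = ladder-* k i }

  a-linear : ∀ {d} (i : Fin d) → IsLinear (a i)
  a-linear = ladder-linear annihilation

  a⁺-linear : ∀ {d} (i : Fin d) → IsLinear (a⁺ i)
  a⁺-linear = ladder-linear creation

  ladder-anticomm₀ : ∀ {d} k (j : Fin d) ψ → ladder k zero (ladder k (suc j) ψ) ≐ λ t → - ladder k (suc j) (ladder k zero ψ) t
  ladder-anticomm₀ annihilation j ψ (false ∷ t) = refl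
  ladder-anticomm₀ annihilation j ψ (true ∷ t)  = sym (trans (-‿involutive _) (0-homo (a-linear j) t))
  ladder-anticomm₀ creation j ψ (false ∷ t)     = sym (trans (-‿cong (0-homo (a⁺-linear j) t)) -0#≈0#)
  ladder-anticomm₀ creation j ψ (true ∷ t)      = sym (-‿involutive _)

  ladder-anticomm : ∀ {d} k (i j : Fin d) ψ → ladder k i (ladder k j ψ) ≐ λ t → - ladder k j (ladder k i ψ) t
  ladder-anticomm k (suc i) (suc j) ψ (false ∷ t) = ladder-anticomm k i j _ t
  ladder-anticomm k (suc i) (suc j) ψ (true ∷ t)  =
    -‿cong (trans (-‿homo (ladder-linear k i) _ t)
           (trans (-‿cong (ladder-anticomm k i j _ t)) (sym (-‿cong (-‿homo (ladder-linear k j) _ t)))))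
  ladder-anticomm k zero (suc j) ψ t = ladder-anticomm₀ k j ψ t
  ladder-anticomm k (suc i) zero ψ t = trans (sym (-‿involutive _)) (-‿cong (sym (ladder-anticomm₀ k i ψ t)))
  ladder-anticomm annihilation zero zero ψ (false ∷ t) = sym -0#≈0#
  ladder-anticomm annihilation zero zero ψ (true ∷ t)  = sym -0#≈0#
  ladder-anticomm creation zero zero ψ (false ∷ t)     = sym -0#≈0#
  ladder-anticomm creation zero zero ψ (true ∷ t)      = sym -0#≈0#

  canonical-anticommutation : ∀ {d} (i j : Fin d) ψ → (λ t → a i (a⁺ j ψ) t + a⁺ j (a i ψ) t) ≐ λ t → δ i j * ψ t
  canonical-anticommutation (suc i) (suc j) ψ (false ∷ t) = canonical-anticommutation i j _ t
  canonical-anticommutation (suc i) (suc j) ψ (true ∷ t)  = begin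
    - a i (λ u → - a⁺ j (ψ ∘ (true ∷_)) u) t + - a⁺ j (λ u → - a i (ψ ∘ (true ∷_)) u) t
      ≈⟨ +-cong (-‿cong (-‿homo (a-linear i) _ t)) (-‿cong (-‿homo (a⁺-linear j) _ t)) ⟩
    - - a i (a⁺ j (ψ ∘ (true ∷_))) t + - - a⁺ j (a i (ψ ∘ (true ∷_))) t
      ≈⟨ +-cong (-‿involutive _) (-‿involutive _) ⟩
    a i (a⁺ j (ψ ∘ (true ∷_))) t + a⁺ j (a i (ψ ∘ (true ∷_))) t
      ≈⟨ canonical-anticommutation i j _ t ⟩
    δ i j * ψ (true ∷ t) ∎
    where open import Relation.Binary.Reasoning.Setoid setoid
  canonical-anticommutation zero zero ψ (false ∷ t)       = trans (+-identityʳ _) (sym (*-identityˡ _))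
  canonical-anticommutation zero zero ψ (true ∷ t)        = trans (+-identityˡ _) (sym (*-identityˡ _))
  canonical-anticommutation zero (suc j) ψ (false ∷ t)    = trans (-‿inverseˡ _) (sym (zeroˡ _))
  canonical-anticommutation zero (suc j) ψ (true ∷ t)     =
    trans (+-identityˡ _) (trans (-‿cong (0-homo (a⁺-linear j) t)) (trans -0#≈0# (sym (zeroˡ _))))
  canonical-anticommutation (suc i) zero ψ (false ∷ t)    = trans (+-identityʳ _) (trans (0-homo (a-linear i) t) (sym (zeroˡ _)))
  canonical-anticommutation (suc i) zero ψ (true ∷ t)     = trans (-‿inverseˡ _) (sym (zeroˡ _))

  a⁺-∅ : ∀ {d} (j : Fin d) ψ → a⁺ j ψ ∅ ≈ 0#
  a⁺-∅ zero    ψ = refl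
  a⁺-∅ (suc j) ψ = a⁺-∅ j _

  size : ∀ {d} → Vec Bool d → ℕ
  size []          = 0
  size (false ∷ t) = size t
  size (true ∷ t)  = suc (size t)

  size≤d : ∀ {d} (t : Vec Bool d) → size t ≤ d
  size≤d []          = z≤n
  size≤d (false ∷ t) = ℕₚ.m≤n⇒m≤1+n (size≤d t)
  size≤d (true ∷ t)  = s≤s (size≤d t)

  VanishesBelow : ∀ {d} → ℕ → Λ d → Set ℓ
  VanishesBelow s ψ = ∀ t → size t < s → ψ t ≈ 0#

  a⁺-vanishesBelow : ∀ {d} (j : Fin d) s ψ → VanishesBelow s ψ → VanishesBelow (suc s) (a⁺ j ψ)
  a⁺-vanishesBelow zero s ψ ψ≈0 (false ∷ t) _ = refl
  a⁺-vanishesBelow zero s ψ ψ≈0 (true ∷ t) (s≤s <s) = ψ≈0 (false ∷ t) <s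
  a⁺-vanishesBelow (suc j) s ψ ψ≈0 (false ∷ t) <s =
    a⁺-vanishesBelow j s (ψ ∘ (false ∷_)) (ψ≈0 ∘ (false ∷_)) t <s
  a⁺-vanishesBelow (suc j) (suc s) ψ ψ≈0 (true ∷ t) (s≤s <s) =
    trans (-‿cong (a⁺-vanishesBelow j s (ψ ∘ (true ∷_)) (λ u <s′ → ψ≈0 (true ∷ u) (s≤s <s′)) t <s)) -0#≈0#

  vanishesBelow-1+d : ∀ {d} {ψ : Λ d} → VanishesBelow (suc d) ψ → ψ ≐ λ _ → 0#
  vanishesBelow-1+d ψ≈0 t = ψ≈0 t (s≤s (size≤d t))

  sign : ℕ → Carrier
  sign zero    = 1#
  sign (suc m) = - sign m

  sign-sq : ∀ m → sign m * sign m ≈ 1#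
  sign-sq zero    = *-identityˡ 1#
  sign-sq (suc m) = trans (sym (-‿distribˡ-* _ _)) (trans (-‿cong (sym (-‿distribʳ-* _ _))) (trans (-‿involutive _) (sign-sq m)))

module TracelessQuasiIdempotent {c ℓ} (R : CommutativeRing c ℓ) where

  open CommutativeRing R hiding (zero)
  open import Algebra.Properties.Ring ring
    using (-0#≈0#; -‿involutive; -‿distribˡ-*; -‿distribʳ-*; -1*x≈-x; x≈z//y; x∙y⁻¹≈ε⇒x≈y; x[y-z]≈xy-xz)
  open import Algebra.Properties.CommutativeSemigroup *-commutativeSemigroup using (x∙yz≈y∙xz)
  open import Relation.Binary.Reasoning.Setoid setoid
  open RingLemmas R
  open Matrices R
  open FermionicFockSpace R

  module Superoperator {d} (N : Matrix d d) where

    Σᴺ : Matrix d d → Carrier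
    Σᴺ F = sum (λ i → sum (λ j → N i j * F i j))

    Σᴺ-cong : ∀ {F G} → F ≈ₘ G → Σᴺ F ≈ Σᴺ G
    Σᴺ-cong F≈G = sum-cong-≋ (λ i → sum-cong-≋ (λ j → *-congˡ (F≈G i j)))

    Σᴺ-+ : ∀ F G → Σᴺ (λ i j → F i j + G i j) ≈ Σᴺ F + Σᴺ G
    Σᴺ-+ F G = trans
      (sum-cong-≋ (λ i → trans (sum-cong-≋ (λ j → distribˡ (N i j) (F i j) (G i j)))
                               (∑-distrib-+ (λ j → N i j * F i j) (λ j → N i j * G i j))))
      (∑-distrib-+ (λ i → sum (λ j → N i j * F i j)) (λ i → sum (λ j → N i j * G i j)))

    Σᴺ-* : ∀ x F → Σᴺ (λ i j → x * F i j) ≈ x * Σᴺ F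
    Σᴺ-* x F = sym (trans (*-distribˡ-sum x (λ i → sum (λ j → N i j * F i j)))
      (sum-cong-≋ (λ i → trans (*-distribˡ-sum x (λ j → N i j * F i j))
                               (sum-cong-≋ (λ j → x∙yz≈y∙xz x (N i j) (F i j))))))

    Σᴺ-0 : Σᴺ (λ _ _ → 0#) ≈ 0#
    Σᴺ-0 = trans (Σᴺ-cong (λ _ _ → sym (zeroˡ 0#))) (trans (Σᴺ-* 0# (λ _ _ → 0#)) (zeroˡ _))

    Σᴺ-‿ : ∀ F → Σᴺ (λ i j → - F i j) ≈ - Σᴺ F
    Σᴺ-‿ F = trans (Σᴺ-cong (λ i j → sym (-1*x≈-x (F i j)))) (trans (Σᴺ-* (- 1#) F) (-1*x≈-x _))

    Σᴺ-δ : ∀ y (f : Fin d → Carrier) → Σᴺ (λ i j → δ i y * f j) ≈ sum (λ j → N y j * f j)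
    Σᴺ-δ y f = begin
      sum (λ i → sum (λ j → N i j * (δ i y * f j)))
        ≈⟨ sum-cong-≋ (λ i → sum-cong-≋ (λ j → x∙yz≈y∙xz (N i j) (δ i y) (f j))) ⟩
      sum (λ i → sum (λ j → δ i y * (N i j * f j)))  ≈⟨ sum-cong-≋ (λ i → *-distribˡ-sum (δ i y) (λ j → N i j * f j)) ⟨
      sum (λ i → δ i y * sum (λ j → N i j * f j))    ≈⟨ sum-cong-≋ (λ i → *-comm (δ i y) _) ⟩
      sum (λ i → sum (λ j → N i j * f j) * δ i y)    ≈⟨ sum-δʳ y (λ i → sum (λ j → N i j * f j)) ⟩
      sum (λ j → N y j * f j)                        ∎

    Σᴺ-homo : ∀ {W} → IsLinear W → (F : Fin d → Fin d → Λ d) →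
              W (λ u → Σᴺ (λ i j → F i j u)) ≐ λ t → Σᴺ (λ i j → W (F i j) t)
    Σᴺ-homo L F t = trans (sum-homo L (λ i u → sum (λ j → N i j * F i j u)) t)
      (sum-cong-≋ (λ i → trans (sum-homo L (λ j u → N i j * F i j u) t)
                               (sum-cong-≋ (λ j → *-homo L (N i j) (F i j) t))))

    T : (Λ d → Λ d) → Λ d → Λ d
    T W ψ t = Σᴺ (λ i j → a i (W (a⁺ j ψ)) t)

    T^ : ℕ → (Λ d → Λ d) → Λ d → Λ d
    T^ zero    W = W
    T^ (suc m) W = T (T^ m W)

    T-cong : ∀ {W V} → (∀ ψ → W ψ ≐ V ψ) → ∀ ψ → T W ψ ≐ T V ψ
    T-cong W≐V ψ t = Σᴺ-cong (λ i j → ≐-cong (a-linear i) (W≐V _) t)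

    T-+ : ∀ W V ψ → T (λ φ u → W φ u + V φ u) ψ ≐ λ t → T W ψ t + T V ψ t
    T-+ W V ψ t = trans (Σᴺ-cong (λ i j → +-homo (a-linear i) _ _ t)) (Σᴺ-+ _ _)

    T-* : ∀ x W ψ → T (λ φ u → x * W φ u) ψ ≐ λ t → x * T W ψ t
    T-* x W ψ t = trans (Σᴺ-cong (λ i j → *-homo (a-linear i) x _ t)) (Σᴺ-* x _)

    T-linear : ∀ {W} → IsLinear W → IsLinear (T W)
    T-linear L = record
      { ≐-cong = λ ψ≐φ t → Σᴺ-cong (λ i j → ≐-cong (a-linear i) (≐-cong L (≐-cong (a⁺-linear j) ψ≐φ)) t)
      ; +-homo = λ ψ φ t → trans
          (Σᴺ-cong (λ i j → trans (≐-cong (a-linear i) (λ u → trans (≐-cong L (+-homo (a⁺-linear j) ψ φ) u)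
                                                                     (+-homo L _ _ u)) t)
                                  (+-homo (a-linear i) _ _ t)))
          (Σᴺ-+ _ _)
      ; *-homo = λ x ψ t → trans
          (Σᴺ-cong (λ i j → trans (≐-cong (a-linear i) (λ u → trans (≐-cong L (*-homo (a⁺-linear j) x ψ) u)
                                                                     (*-homo L x _ u)) t)
                                  (*-homo (a-linear i) x _ t)))
          (Σᴺ-* x _)
      }

    T^-linear : ∀ {W} → IsLinear W → ∀ m → IsLinear (T^ m W)
    T^-linear L zero    = L
    T^-linear L (suc m) = T-linear (T^-linear L m)

    T^-cong : ∀ {W V} → (∀ ψ → W ψ ≐ V ψ) → ∀ m ψ → T^ m W ψ ≐ T^ m V ψ
    T^-cong W≐V zero    = W≐V
    T^-cong W≐V (suc m) = T-cong (T^-cong W≐V m)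

    T^-+ : ∀ m W V ψ → T^ m (λ φ u → W φ u + V φ u) ψ ≐ λ t → T^ m W ψ t + T^ m V ψ t
    T^-+ zero    W V ψ t = refl
    T^-+ (suc m) W V ψ t = trans (T-cong (T^-+ m W V) ψ t) (T-+ (T^ m W) (T^ m V) ψ t)

    T^-* : ∀ m x W ψ → T^ m (λ φ u → x * W φ u) ψ ≐ λ t → x * T^ m W ψ t
    T^-* zero    x W ψ t = refl
    T^-* (suc m) x W ψ t = trans (T-cong (T^-* m x W) ψ t) (T-* x (T^ m W) ψ t)

    T^-‿ : ∀ m W ψ → T^ m (λ φ u → - W φ u) ψ ≐ λ t → - T^ m W ψ t
    T^-‿ m W ψ t = trans (T^-cong (λ φ u → sym (-1*x≈-x (W φ u))) m ψ t) (trans (T^-* m (- 1#) W ψ t) (-1*x≈-x _))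

    AnticommutesWithCreation : (Λ d → Λ d) → Set (c ⊔ ℓ)
    AnticommutesWithCreation A = ∀ j ψ → a⁺ j (A ψ) ≐ λ t → - A (a⁺ j ψ) t

    T-anticomm : ∀ {W A} → IsLinear W → AnticommutesWithCreation A →
                 ∀ ψ → T W (A ψ) ≐ λ t → - T (W ∘ A) ψ t
    T-anticomm L anti ψ t = trans
      (Σᴺ-cong (λ i j → trans (≐-cong (a-linear i) (λ u → trans (≐-cong L (anti j ψ) u) (-‿homo L _ u)) t)
                              (-‿homo (a-linear i) _ t)))
      (Σᴺ-‿ _)

    T^-anticomm : ∀ {W A} → IsLinear W → AnticommutesWithCreation A →
                  ∀ m ψ → T^ m W (A ψ) ≐ λ t → sign m * T^ m (W ∘ A) ψ t
    T^-anticomm L anti zero    ψ t = sym (*-identityˡ _)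
    T^-anticomm {W} {A} L anti (suc m) ψ t = begin
      T (T^ m W) (A ψ) t                             ≈⟨ T-anticomm (T^-linear L m) anti ψ t ⟩
      - T (T^ m W ∘ A) ψ t                           ≈⟨ -‿cong (T-cong (T^-anticomm L anti m) ψ t) ⟩
      - T (λ φ u → sign m * T^ m (W ∘ A) φ u) ψ t    ≈⟨ -‿cong (T-* (sign m) (T^ m (W ∘ A)) ψ t) ⟩
      - (sign m * T^ (suc m) (W ∘ A) ψ t)            ≈⟨ -‿distribˡ-* _ _ ⟩
      sign (suc m) * T^ (suc m) (W ∘ A) ψ t          ∎

    a⁺-anticomm : ∀ y → AnticommutesWithCreation (a⁺ y)
    a⁺-anticomm y j = ladder-anticomm creation j y

    a-T : ∀ x W ψ → a x (T W ψ) ≐ λ t → - T (a x ∘ W) ψ t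
    a-T x W ψ t = trans (Σᴺ-homo (a-linear x) (λ i j → a i (W (a⁺ j ψ))) t)
      (trans (Σᴺ-cong (λ i j → ladder-anticomm annihilation x i _ t)) (Σᴺ-‿ _))

    a-T^ : ∀ m x W ψ → a x (T^ m W ψ) ≐ λ t → sign m * T^ m (a x ∘ W) ψ t
    a-T^ zero    x W ψ t = sym (*-identityˡ _)
    a-T^ (suc m) x W ψ t = begin
      a x (T (T^ m W) ψ) t                              ≈⟨ a-T x (T^ m W) ψ t ⟩
      - T (a x ∘ T^ m W) ψ t                            ≈⟨ -‿cong (T-cong (a-T^ m x W) ψ t) ⟩
      - T (λ φ u → sign m * T^ m (a x ∘ W) φ u) ψ t     ≈⟨ -‿cong (T-* (sign m) (T^ m (a x ∘ W)) ψ t) ⟩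
      - (sign m * T^ (suc m) (a x ∘ W) ψ t)             ≈⟨ -‿distribˡ-* _ _ ⟩
      sign (suc m) * T^ (suc m) (a x ∘ W) ψ t           ∎

    a⁺ᴺ : Fin d → Λ d → Λ d
    a⁺ᴺ y ψ u = sum (λ j → N y j * a⁺ j ψ u)

    linear-a⁺ᴺ : ∀ {W} → IsLinear W → ∀ y ψ → W (a⁺ᴺ y ψ) ≐ λ t → sum (λ j → N y j * W (a⁺ j ψ) t)
    linear-a⁺ᴺ L y ψ t = trans (sum-homo L (λ j u → N y j * a⁺ j ψ u) t)
      (sum-cong-≋ (λ j → *-homo L (N y j) (a⁺ j ψ) t))

    a⁺ᴺ-anticomm : ∀ y → AnticommutesWithCreation (a⁺ᴺ y)
    a⁺ᴺ-anticomm y j ψ t = begin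
      a⁺ j (a⁺ᴺ y ψ) t                                 ≈⟨ linear-a⁺ᴺ (a⁺-linear j) y ψ t ⟩
      sum (λ l → N y l * a⁺ j (a⁺ l ψ) t)              ≈⟨ sum-cong-≋ (λ l → *-congˡ (ladder-anticomm creation j l ψ t)) ⟩
      sum (λ l → N y l * - a⁺ l (a⁺ j ψ) t)            ≈⟨ sum-cong-≋ (λ l → -‿distribʳ-* (N y l) (a⁺ l (a⁺ j ψ) t)) ⟨
      sum (λ l → - (N y l * a⁺ l (a⁺ j ψ) t))          ≈⟨ -‿distrib-sum (λ l → N y l * a⁺ l (a⁺ j ψ) t) ⟨
      - a⁺ᴺ y (a⁺ j ψ) t                               ∎

    T-a⁺ : ∀ {W} → IsLinear W → ∀ y ψ → T (a⁺ y ∘ W) ψ ≐ λ t → W (a⁺ᴺ y ψ) t - a⁺ y (T W ψ) t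
    T-a⁺ {W} L y ψ t = x≈z//y _ _ _ (begin
      T (a⁺ y ∘ W) ψ t + a⁺ y (T W ψ) t
        ≈⟨ +-comm _ _ ⟩
      a⁺ y (T W ψ) t + T (a⁺ y ∘ W) ψ t
        ≈⟨ +-congʳ (Σᴺ-homo (a⁺-linear y) (λ i j → a i (X j)) t) ⟩
      Σᴺ (λ i j → a⁺ y (a i (X j)) t) + Σᴺ (λ i j → a i (a⁺ y (X j)) t)
        ≈⟨ Σᴺ-+ _ _ ⟨
      Σᴺ (λ i j → a⁺ y (a i (X j)) t + a i (a⁺ y (X j)) t)
        ≈⟨ Σᴺ-cong (λ i j → trans (+-comm _ _) (canonical-anticommutation i y (X j) t)) ⟩
      Σᴺ (λ i j → δ i y * X j t)
        ≈⟨ Σᴺ-δ y (λ j → X j t) ⟩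
      sum (λ j → N y j * X j t)
        ≈⟨ linear-a⁺ᴺ L y ψ t ⟨
      W (a⁺ᴺ y ψ) t ∎)
      where
      X : Fin d → Λ d
      X j = W (a⁺ j ψ)

    T^-a⁺ : ∀ {W} → IsLinear W → ∀ m y ψ →
            T^ (suc m) (a⁺ y ∘ W) ψ ≐ λ t → (sign m * ι (suc m)) * T^ m W (a⁺ᴺ y ψ) t
                                             + sign (suc m) * a⁺ y (T^ (suc m) W ψ) t
    T^-a⁺ {W} L zero y ψ t = trans (T-a⁺ L y ψ t) (+-cong (sym P≈1ι1P) (sym (-1*x≈-x _)))
      where
      P≈1ι1P : (1# * (1# + 0#)) * W (a⁺ᴺ y ψ) t ≈ W (a⁺ᴺ y ψ) t
      P≈1ι1P = trans (*-congʳ (trans (*-identityˡ _) (+-identityʳ 1#))) (*-identityˡ _)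
    T^-a⁺ {W} L (suc m) y ψ t = begin
      T (T^ (suc m) (a⁺ y ∘ W)) ψ t
        ≈⟨ T-cong (T^-a⁺ L m y) ψ t ⟩
      T (λ φ u → α * T^ m W (a⁺ᴺ y φ) u + sign (suc m) * a⁺ y (T^ (suc m) W φ) u) ψ t
        ≈⟨ T-+ (λ φ u → α * T^ m W (a⁺ᴺ y φ) u) (λ φ u → sign (suc m) * a⁺ y (T^ (suc m) W φ) u) ψ t ⟩
      T (λ φ u → α * T^ m W (a⁺ᴺ y φ) u) ψ t + T (λ φ u → sign (suc m) * a⁺ y (T^ (suc m) W φ) u) ψ t
        ≈⟨ +-cong (T-* α (T^ m W ∘ a⁺ᴺ y) ψ t) (T-* (sign (suc m)) (a⁺ y ∘ T^ (suc m) W) ψ t) ⟩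
      α * T (T^ m W ∘ a⁺ᴺ y) ψ t + sign (suc m) * T (a⁺ y ∘ T^ (suc m) W) ψ t
        ≈⟨ +-cong (*-congˡ (sym (trans (-‿cong (T-anticomm (T^-linear L m) (a⁺ᴺ-anticomm y) ψ t)) (-‿involutive _))))
                  (*-congˡ (T-a⁺ (T^-linear L (suc m)) y ψ t)) ⟩
      α * - P + sign (suc m) * (P - Q)
        ≈⟨ regroup (sign m) (ι (suc m)) P Q ⟩
      (sign (suc m) * ι (suc (suc m))) * P + sign (suc (suc m)) * Q ∎
      where
      α P Q : Carrier
      α = sign m * ι (suc m)
      P = T^ (suc m) W (a⁺ᴺ y ψ) t
      Q = a⁺ y (T^ (suc (suc m)) W ψ) t
      regroup : ∀ s i P Q → (s * i) * - P + (- s) * (P - Q) ≈ ((- s) * (1# + i)) * P + (- (- s)) * Q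
      regroup s i P Q = begin
        (s * i) * - P + (- s) * (P - Q)              ≈⟨ +-cong (sym (-‿distribʳ-* _ _)) (x[y-z]≈xy-xz (- s) P Q) ⟩
        - ((s * i) * P) + ((- s) * P - (- s) * Q)    ≈⟨ sym (+-assoc _ _ _) ⟩
        - ((s * i) * P) + (- s) * P - (- s) * Q      ≈⟨ +-cong (+-comm _ _) (-‿cong (sym (-‿distribˡ-* s Q))) ⟩
        (- s) * P + - ((s * i) * P) + - - (s * Q)    ≈⟨ +-cong (+-congˡ (-‿cong (*-assoc s i P))) (-‿involutive _) ⟩
        (- s) * P + - (s * (i * P)) + s * Q          ≈⟨ +-cong (+-congˡ (-‿distribˡ-* s (i * P))) (*-congʳ (sym (-‿involutive s))) ⟩
        (- s) * P + (- s) * (i * P) + (- (- s)) * Q  ≈⟨ +-congʳ (sym (distribˡ (- s) P (i * P))) ⟩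
        (- s) * (P + i * P) + (- (- s)) * Q          ≈⟨ +-congʳ (*-congˡ (+-congʳ (*-identityˡ P))) ⟨
        (- s) * (1# * P + i * P) + (- (- s)) * Q     ≈⟨ +-congʳ (*-congˡ (distribʳ P 1# i)) ⟨
        (- s) * ((1# + i) * P) + (- (- s)) * Q       ≈⟨ +-congʳ (*-assoc (- s) (1# + i) P) ⟨
        ((- s) * (1# + i)) * P + (- (- s)) * Q       ∎

    𝟙 : Λ d
    𝟙 _ = 1#

    -- The operators below conserve the number of particles, so their vacuum
    -- expectations can be computed on 𝟙 instead of the vacuum.
    ⟨_⟩ : (Λ d → Λ d) → Carrier
    ⟨ W ⟩ = W 𝟙 ∅

    S : ℕ → Carrier
    S m = ⟨ T^ m id ⟩

    M : ℕ → Matrix d d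
    M m x y = ⟨ T^ m (a x ∘ a⁺ y) ⟩

    M-zero : M 0 ≈ₘ 1ₘ
    M-zero x y = begin
      a x (a⁺ y 𝟙) ∅                  ≈⟨ x≈z//y _ _ _ (canonical-anticommutation x y 𝟙 ∅) ⟩
      δ x y * 1# - a⁺ y (a x 𝟙) ∅     ≈⟨ +-cong (*-identityʳ _) (-‿cong (a⁺-∅ y _)) ⟩
      δ x y - 0#                      ≈⟨ +-congˡ -0#≈0# ⟩
      δ x y + 0#                      ≈⟨ +-identityʳ _ ⟩
      δ x y                           ∎

    S-suc : ∀ m → S (suc m) ≈ Σᴺ (M m)
    S-suc m = Σᴺ-cong (λ i j → begin
      a i (T^ m id (a⁺ j 𝟙)) ∅         ≈⟨ a-T^ m i id _ ∅ ⟩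
      sign m * T^ m (a i) (a⁺ j 𝟙) ∅   ≈⟨ *-congˡ (T^-anticomm (a-linear i) (a⁺-anticomm j) m 𝟙 ∅) ⟩
      sign m * (sign m * M m i j)      ≈⟨ *-assoc _ _ _ ⟨
      (sign m * sign m) * M m i j      ≈⟨ *-congʳ (sign-sq m) ⟩
      1# * M m i j                     ≈⟨ *-identityˡ _ ⟩
      M m i j                          ∎)

    M-suc : ∀ m x y → M (suc m) x y ≈ δ x y * S (suc m) - ι (suc m) * sum (λ j → N y j * M m x j)
    M-suc m x y = begin
      T^ (suc m) (a x ∘ a⁺ y) 𝟙 ∅
        ≈⟨ T^-cong (λ φ u → x≈z//y _ _ _ (canonical-anticommutation x y φ u)) (suc m) 𝟙 ∅ ⟩
      T^ (suc m) (λ φ u → δ x y * φ u - a⁺ y (a x φ) u) 𝟙 ∅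
        ≈⟨ T^-+ (suc m) (λ φ u → δ x y * φ u) (λ φ u → - a⁺ y (a x φ) u) 𝟙 ∅ ⟩
      T^ (suc m) (λ φ u → δ x y * φ u) 𝟙 ∅ + T^ (suc m) (λ φ u → - a⁺ y (a x φ) u) 𝟙 ∅
        ≈⟨ +-cong (T^-* (suc m) (δ x y) id 𝟙 ∅) (T^-‿ (suc m) (a⁺ y ∘ a x) 𝟙 ∅) ⟩
      δ x y * S (suc m) - T^ (suc m) (a⁺ y ∘ a x) 𝟙 ∅
        ≈⟨ +-congˡ (-‿cong (T^-a⁺ (a-linear x) m y 𝟙 ∅)) ⟩
      δ x y * S (suc m) - ((sign m * ι (suc m)) * T^ m (a x) (a⁺ᴺ y 𝟙) ∅
                           + sign (suc m) * a⁺ y (T^ (suc m) (a x) 𝟙) ∅)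
        ≈⟨ +-congˡ (-‿cong (trans (+-congˡ (trans (*-congˡ (a⁺-∅ y _)) (zeroʳ _))) (+-identityʳ _))) ⟩
      δ x y * S (suc m) - (sign m * ι (suc m)) * T^ m (a x) (a⁺ᴺ y 𝟙) ∅
        ≈⟨ +-congˡ (-‿cong (*-congˡ (linear-a⁺ᴺ (T^-linear (a-linear x) m) y 𝟙 ∅))) ⟩
      δ x y * S (suc m) - (sign m * ι (suc m)) * sum (λ j → N y j * T^ m (a x) (a⁺ j 𝟙) ∅)
        ≈⟨ +-congˡ (-‿cong (*-congˡ (sum-cong-≋ (λ j →
             *-congˡ (T^-anticomm (a-linear x) (a⁺-anticomm j) m 𝟙 ∅))))) ⟩
      δ x y * S (suc m) - (sign m * ι (suc m)) * sum (λ j → N y j * (sign m * M m x j))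
        ≈⟨ +-congˡ (-‿cong (cancel-sign (sign m) (ι (suc m)) (N y) (M m x) (sign-sq m))) ⟩
      δ x y * S (suc m) - ι (suc m) * sum (λ j → N y j * M m x j) ∎
      where
      cancel-sign : ∀ s i (f g : Fin d → Carrier) → s * s ≈ 1# →
                    (s * i) * sum (λ j → f j * (s * g j)) ≈ i * sum (λ j → f j * g j)
      cancel-sign s i f g s²≈1 = begin
        (s * i) * sum (λ j → f j * (s * g j))   ≈⟨ *-congˡ (sum-cong-≋ (λ j → x∙yz≈y∙xz (f j) s (g j))) ⟩
        (s * i) * sum (λ j → s * (f j * g j))   ≈⟨ *-congˡ (*-distribˡ-sum s (λ j → f j * g j)) ⟨
        (s * i) * (s * sum (λ j → f j * g j))   ≈⟨ *-congʳ (*-comm s i) ⟩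
        (i * s) * (s * sum (λ j → f j * g j))   ≈⟨ *-assoc i s _ ⟩
        i * (s * (s * sum (λ j → f j * g j)))   ≈⟨ *-congˡ (sym (*-assoc s s _)) ⟩
        i * ((s * s) * sum (λ j → f j * g j))   ≈⟨ *-congˡ (trans (*-congʳ s²≈1) (*-identityˡ _)) ⟩
        i * sum (λ j → f j * g j)               ∎

    Kills : ℕ → (Λ d → Λ d) → Set (c ⊔ ℓ)
    Kills s W = ∀ ψ → VanishesBelow s ψ → W ψ ≐ λ _ → 0#

    T-kills : ∀ s W → Kills (suc s) W → Kills s (T W)
    T-kills s W kills ψ ψ≈0 t = trans
      (Σᴺ-cong (λ i j → trans (≐-cong (a-linear i) (kills (a⁺ j ψ) (a⁺-vanishesBelow j s ψ ψ≈0)) t)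
                              (0-homo (a-linear i) t)))
      Σᴺ-0

    T^-kills : ∀ m s W → Kills (m ℕ.+ s) W → Kills s (T^ m W)
    T^-kills zero    s W kills = kills
    T^-kills (suc m) s W kills =
      T-kills s (T^ m W) (T^-kills m (suc s) W (≡.subst (λ k → Kills k W) (≡.sym (ℕₚ.+-suc m s)) kills))

    M-top : M d ≈ₘ 0ₘ
    M-top x y = T^-kills d 0 (a x ∘ a⁺ y) kills (λ _ → 1#) (λ _ ()) ∅
      where
      kills : Kills (d ℕ.+ 0) (a x ∘ a⁺ y)
      kills ψ ψ≈0 t = trans
        (≐-cong (a-linear x) (vanishesBelow-1+d (a⁺-vanishesBelow y _ ψ
          (≡.subst (λ k → VanishesBelow k ψ) (ℕₚ.+-identityʳ d) ψ≈0))) t)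
        (0-homo (a-linear x) t)

    module Newton (μ : Carrier) (N²≈μN : N · N ≈ₘ μ ⊛ N) (trN≈0 : trace N ≈ 0#) where

      κ : ℕ → Carrier
      κ zero    = - 1#
      κ (suc m) = - (ι (suc (suc m)) * (κ m * μ))

      newton : ∀ m → S (suc m) ≈ 0# × M (suc m) ≈ₘ κ m ⊛ N ᵀ
      newton zero = S₁≈0 , M₁≈κN
        where
        S₁≈0 : S 1 ≈ 0#
        S₁≈0 = begin
          S 1                                     ≈⟨ S-suc 0 ⟩
          Σᴺ (M 0)                                ≈⟨ Σᴺ-cong M-zero ⟩
          sum (λ i → sum (λ j → N i j * δ i j))   ≈⟨ sum-cong-≋ (λ i → sum-cong-≋ (λ j → *-congˡ {N i j} (reflexive (δ-sym i j)))) ⟩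
          sum (λ i → sum (λ j → N i j * δ j i))   ≈⟨ sum-cong-≋ (λ i → sum-δʳ i (N i)) ⟩
          trace N                                 ≈⟨ trN≈0 ⟩
          0#                                      ∎
        M₁≈κN : M 1 ≈ₘ κ 0 ⊛ N ᵀ
        M₁≈κN x y = begin
          M 1 x y
            ≈⟨ M-suc 0 x y ⟩
          δ x y * S 1 - ι 1 * sum (λ j → N y j * M 0 x j)
            ≈⟨ +-cong (trans (*-congˡ S₁≈0) (zeroʳ _)) (-‿cong (*-congʳ (+-identityʳ 1#))) ⟩
          0# - 1# * sum (λ j → N y j * M 0 x j)
            ≈⟨ +-congˡ (-‿cong (*-congˡ (sum-cong-≋ (λ j → *-congˡ {N y j} (trans (M-zero x j) (reflexive (δ-sym x j))))))) ⟩
          0# - 1# * sum (λ j → N y j * δ j x)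
            ≈⟨ trans (+-identityˡ _) (-‿distribˡ-* 1# _) ⟩
          - 1# * sum (λ j → N y j * δ j x)
            ≈⟨ *-congˡ (sum-δʳ x (N y)) ⟩
          - 1# * N y x ∎
      newton (suc m) = S≈0 , M≈κN
        where
        IH : S (suc m) ≈ 0# × M (suc m) ≈ₘ κ m ⊛ N ᵀ
        IH = newton m
        S≈0 : S (suc (suc m)) ≈ 0#
        S≈0 = begin
          S (suc (suc m))                       ≈⟨ S-suc (suc m) ⟩
          Σᴺ (M (suc m))                        ≈⟨ Σᴺ-cong (proj₂ IH) ⟩
          Σᴺ (λ i j → κ m * N j i)              ≈⟨ Σᴺ-* (κ m) (N ᵀ) ⟩
          κ m * trace (N · N)                   ≈⟨ *-congˡ (trace-cong N²≈μN) ⟩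
          κ m * trace (μ ⊛ N)                   ≈⟨ *-congˡ (trans (trace-⊛ μ N) (trans (*-congˡ trN≈0) (zeroʳ μ))) ⟩
          κ m * 0#                              ≈⟨ zeroʳ _ ⟩
          0#                                    ∎
        M≈κN : M (suc (suc m)) ≈ₘ κ (suc m) ⊛ N ᵀ
        M≈κN x y = begin
          M (suc (suc m)) x y
            ≈⟨ M-suc (suc m) x y ⟩
          δ x y * S (suc (suc m)) - ι₂ * sum (λ j → N y j * M (suc m) x j)
            ≈⟨ +-cong (trans (*-congˡ S≈0) (zeroʳ _)) (-‿cong (*-congˡ (sum-cong-≋ (λ j → *-congˡ (proj₂ IH x j))))) ⟩
          0# - ι₂ * sum (λ j → N y j * (κ m * N j x))
            ≈⟨ +-identityˡ _ ⟩
          - (ι₂ * sum (λ j → N y j * (κ m * N j x)))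
            ≈⟨ -‿cong (*-congˡ (trans (sum-cong-≋ (λ j → x∙yz≈y∙xz (N y j) (κ m) (N j x)))
                                      (sym (*-distribˡ-sum (κ m) (λ j → N y j * N j x))))) ⟩
          - (ι₂ * (κ m * (N · N) y x))
            ≈⟨ -‿cong (*-congˡ (*-congˡ (N²≈μN y x))) ⟩
          - (ι₂ * (κ m * (μ * N y x)))
            ≈⟨ -‿cong (trans (*-congˡ (sym (*-assoc (κ m) μ (N y x)))) (sym (*-assoc ι₂ _ (N y x)))) ⟩
          - ((ι₂ * (κ m * μ)) * N y x)
            ≈⟨ -‿distribˡ-* _ (N y x) ⟩
          κ (suc m) * N y x ∎
          where
          ι₂ : Carrier
          ι₂ = ι (suc (suc m))

      κ-isUnit : IsUnit μ → (∀ k → 1 ≤ k → k ≤ d → IsUnit (ι k)) → ∀ m → suc m ≤ d → IsUnit (κ m)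
      κ-isUnit μ-unit ι-unit zero    _ = -‿isUnit (1# , *-identityˡ 1#)
      κ-isUnit μ-unit ι-unit (suc m) h = -‿isUnit (*-isUnit (ι-unit (suc (suc m)) (s≤s z≤n) h)
        (*-isUnit (κ-isUnit μ-unit ι-unit m (ℕₚ.≤-trans (ℕₚ.n≤1+n (suc m)) h)) μ-unit))

  quasiIdempotent-traceless⇒0 : ∀ {d} (N : Matrix d d) μ → N · N ≈ₘ μ ⊛ N → trace N ≈ 0# → IsUnit μ →
                                (∀ k → 1 ≤ k → k ≤ d → IsUnit (ι k)) → N ≈ₘ 0ₘ
  quasiIdempotent-traceless⇒0 {zero}  N μ _ _ _ _ ()
  quasiIdempotent-traceless⇒0 {suc d} N μ N²≈μN trN≈0 μ-unit ι-unit x y =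
    isUnit-cancelˡ (κ-isUnit μ-unit ι-unit d ℕₚ.≤-refl) (trans (sym (proj₂ (newton d) y x)) (M-top y x))
    where
    open Superoperator N
    open Newton μ N²≈μN trN≈0

  quasiIdempotent⇒scalar : ∀ {d} (X : Matrix d d) x → X · X ≈ₘ x ⊛ X → trace X ≈ x * ι d → IsUnit x →
                           (∀ k → 1 ≤ k → k ≤ d → IsUnit (ι k)) → X ≈ₘ x ⊛ 1ₘ
  quasiIdempotent⇒scalar {d} X x X²≈xX trX≈xd x-unit ι-unit i j = x∙y⁻¹≈ε⇒x≈y _ _
    (quasiIdempotent-traceless⇒0 (X ⊟ x ⊛ 1ₘ) (- x) (shift-quasiIdempotent X x X²≈xX) trace≈0 (-‿isUnit x-unit) ι-unit i j)
    where
    trace≈0 : trace (X ⊟ x ⊛ 1ₘ) ≈ 0#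
    trace≈0 = begin
      trace (X ⊟ x ⊛ 1ₘ)        ≈⟨ trace-⊟ X (x ⊛ 1ₘ) ⟩
      trace X - trace (x ⊛ 1ₘ {d}) ≈⟨ +-cong trX≈xd (-‿cong (trans (trace-⊛ x (1ₘ {d})) (*-congˡ (trace-1ₘ d)))) ⟩
      x * ι d - x * ι d         ≈⟨ -‿inverseʳ _ ⟩
      0#                        ∎

module TightFrames {c ℓ} (F : InvolutiveField c ℓ) where

  open FieldTheory F hiding (zero)
  open import Algebra.Properties.Ring ring using (x+x≈x⇒x≈0; x∙y⁻¹≈ε⇒x≈y; [y-z]x≈yx-zx)
  open RingLemmas commutativeRing
    using (δ; sum-δˡ; sum-⊟; sum-cong-≋; sum-replicate; sum-replicate-zero; *-distribˡ-sum; ι-*; IsUnit; isUnit-cancelˡ)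
  open Matrices commutativeRing

  field-isUnit : ∀ {x} → ¬ (x ≈ 0#) → IsUnit x
  field-isUnit {x} x≉0 = proj₁ (inverse x x≉0) , trans (*-comm _ x) (proj₂ (inverse x x≉0))

  σ-0 : σ 0# ≈ 0#
  σ-0 = x+x≈x⇒x≈0 (σ 0#) (trans (sym (σ-+ 0# 0#)) (σ-cong (+-identityʳ 0#)))

  lincomb-⊟ : ∀ {k m} (ψ : Fin k → Vec m) x c₀ y →
              lincomb ψ (λ j → x j - c₀ * y j) ≋ λ i → lincomb ψ x i - c₀ * lincomb ψ y i
  lincomb-⊟ ψ x c₀ y i = begin
    sum (λ j → (x j - c₀ * y j) * ψ j i)                  ≈⟨ sum-cong-≋ (λ j → [y-z]x≈yx-zx (ψ j i) (x j) (c₀ * y j)) ⟩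
    sum (λ j → x j * ψ j i - c₀ * y j * ψ j i)            ≈⟨ sum-⊟ (λ j → x j * ψ j i) (λ j → c₀ * y j * ψ j i) ⟩
    lincomb ψ x i - sum (λ j → c₀ * y j * ψ j i)          ≈⟨ +-congˡ (-‿cong (sum-cong-≋ (λ j → *-assoc c₀ (y j) (ψ j i)))) ⟩
    lincomb ψ x i - sum (λ j → c₀ * (y j * ψ j i))        ≈⟨ +-congˡ (-‿cong (*-distribˡ-sum c₀ (λ j → y j * ψ j i))) ⟨
    lincomb ψ x i - c₀ * lincomb ψ y i                    ∎
    where open import Relation.Binary.Reasoning.Setoid setoid

  lincomb-zero : ∀ {k m} (ψ : Fin k → Vec m) {x} → (∀ j → x j ≈ 0#) → lincomb ψ x ≋ 0ᵥ
  lincomb-zero {k} ψ x≈0 i = trans (sum-cong-≋ (λ j → trans (*-congʳ (x≈0 j)) (zeroˡ (ψ j i)))) (sum-replicate-zero k)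

  module _ {m} (V : NonIsotropicSpace m) where

    open NonIsotropicSpace V

    form-congʳ : ∀ u {v w} → v ≋ w → ⟪ u , v ⟫ ≈ ⟪ u , w ⟫
    form-congʳ u = form-cong (λ _ → refl)

    form-lincomb : ∀ {k} u (ψ : Fin k → Vec m) x → ⟪ u , lincomb ψ x ⟫ ≈ sum (λ j → ⟪ u , ψ j ⟫ * x j)
    form-lincomb {zero} u ψ x =
      trans (form-congʳ u {w = 0# ⊙ 0ᵥ} (λ _ → sym (zeroˡ 0#))) (trans (homogeneousʳ u 0# 0ᵥ) (zeroˡ _))
    form-lincomb {suc k} u ψ x = begin
      ⟪ u , (x zero ⊙ ψ zero) ⊕ lincomb (ψ ∘ suc) (x ∘ suc) ⟫         ≈⟨ additiveʳ u _ _ ⟩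
      ⟪ u , x zero ⊙ ψ zero ⟫ + ⟪ u , lincomb (ψ ∘ suc) (x ∘ suc) ⟫   ≈⟨ +-cong (trans (homogeneousʳ u (x zero) (ψ zero)) (*-comm _ _))
                                                                             (form-lincomb u (ψ ∘ suc) (x ∘ suc)) ⟩
      ⟪ u , ψ zero ⟫ * x zero + sum (λ j → ⟪ u , ψ (suc j) ⟫ * x (suc j)) ∎
      where open import Relation.Binary.Reasoning.Setoid setoid

    cross : ∀ {p q} → (Fin p → Vec m) → (Fin q → Vec m) → Matrix p q
    cross Ξ Ψ j k = ⟪ Ξ j , Ψ k ⟫

    cross-lincomb : ∀ {p q r} (Ξ : Fin p → Vec m) (Ψ : Fin q → Vec m) (Y : Matrix r q) {Θ : Fin r → Vec m} →
                    (∀ k → lincomb Ψ (Y k) ≋ Θ k) → cross Ξ Θ ≈ₘ cross Ξ Ψ · Y ᵀ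
    cross-lincomb Ξ Ψ Y Θ≋ j k = trans (form-congʳ (Ξ j) (λ i → sym (Θ≋ k i))) (form-lincomb (Ξ j) Ψ (Y k))

    module _ {n} (Φ : Fin n → Vec m) where

      φ∈image : ∀ j → image V Φ (Φ j)
      φ∈image j = δ j , λ i → sum-δˡ j (λ l → Φ l i)

      adjoint-synthesis : ∀ y → column (adjoint V Φ (synthesis V Φ y)) ≈ₘ gram V Φ · column y
      adjoint-synthesis y j _ = form-lincomb (Φ j) Φ y

      trace-gram : ∀ {a} → (∀ j → ⟪ Φ j , Φ j ⟫ ≈ a) → trace (gram V Φ) ≈ ι n * a
      trace-gram {a} ‖φ‖²≈a = trans (sum-cong-≋ ‖φ‖²≈a) (trans (sum-replicate n) (sym (ι-* n a)))

      gram-annihilates-residual : ∀ c₀ → GramSquareIs V Φ c₀ → ∀ p y → column p ≈ₘ gram V Φ · column y →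
                                  gram V Φ · (column p ⊟ c₀ ⊛ column y) ≈ₘ 0ₘ
      gram-annihilates-residual c₀ G²≈c₀G p y p≈Gy = begin
        G · (column p ⊟ c₀ ⊛ column y)            ≈⟨ ·-distribˡ-⊟ G (column p) (c₀ ⊛ column y) ⟩
        G · column p ⊟ G · (c₀ ⊛ column y)        ≈⟨ ⊟-cong (·-cong ≈ₘ-refl p≈Gy) (·-⊛ G c₀ (column y)) ⟩
        G · (G · column y) ⊟ c₀ ⊛ (G · column y)  ≈⟨ ⊟-cong (≈ₘ-sym (·-assoc G G (column y))) ≈ₘ-refl ⟩
        G · G · column y ⊟ c₀ ⊛ (G · column y)    ≈⟨ ⊟-cong (·-cong G²≈c₀G ≈ₘ-refl) ≈ₘ-refl ⟩
        (c₀ ⊛ G) · column y ⊟ c₀ ⊛ (G · column y) ≈⟨ ⊟-cong (⊛-· c₀ G (column y)) ≈ₘ-refl ⟩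
        c₀ ⊛ (G · column y) ⊟ c₀ ⊛ (G · column y) ≈⟨ ⊟-self (c₀ ⊛ (G · column y)) ⟩
        0ₘ                                        ∎
        where
        open ≈ₘ-Reasoning
        G : Matrix n n
        G = gram V Φ

      module _ (orthogonal⇒0 : ∀ u → image V Φ u → (∀ j → ⟪ Φ j , u ⟫ ≈ 0#) → u ≋ 0ᵥ) where

        image-nonIsotropic : IsNonIsotropic V (image V Φ)
        image-nonIsotropic u u∈im u⊥im = orthogonal⇒0 u u∈im (λ j →
          trans (hermitian (Φ j) u) (trans (σ-cong (u⊥im (Φ j) (φ∈image j))) σ-0))

        tightFrame : ∀ c₀ → GramSquareIs V Φ c₀ → IsTightFrame V Φ c₀ (image V Φ)
        tightFrame c₀ G²≈c₀G = (φ∈image , λ _ u∈im → u∈im) , tight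
          where
          tight : ∀ u → image V Φ u → synthesis V Φ (adjoint V Φ u) ≋ (c₀ ⊙ u)
          tight u (y , Φy≋u) i = begin
            synthesis V Φ p i        ≈⟨ x∙y⁻¹≈ε⇒x≈y _ _ (trans (sym (lincomb-⊟ Φ p c₀ y i)) (Φz≋0 i)) ⟩
            c₀ * synthesis V Φ y i   ≈⟨ *-congˡ (Φy≋u i) ⟩
            c₀ * u i                 ∎
            where
            open import Relation.Binary.Reasoning.Setoid setoid
            p z : Vec n
            p = adjoint V Φ u
            z l = p l - c₀ * y l
            p≈Gy : column p ≈ₘ gram V Φ · column y
            p≈Gy l k = trans (form-congʳ (Φ l) (λ i → sym (Φy≋u i))) (adjoint-synthesis y l k)
            Φz≋0 : synthesis V Φ z ≋ 0ᵥ
            Φz≋0 = orthogonal⇒0 (synthesis V Φ z) (z , λ _ → refl) (λ j →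
              trans (adjoint-synthesis z j zero) (gram-annihilates-residual c₀ G²≈c₀G p y p≈Gy j zero))

      module Coordinates {d} (b : Fin d → Vec m) (b∈im : ∀ k → image V Φ (b k))
                         (b-spans : ∀ v → image V Φ v → ∃ λ x → lincomb b x ≋ v) where

        A : Matrix n d
        A j = proj₁ (b-spans (Φ j) (φ∈image j))

        C : Matrix d n
        C k = proj₁ (b∈im k)

        H : Matrix n d
        H = cross Φ b

        K : Matrix d d
        K = A ᵀ · H

        G≈HAᵀ : gram V Φ ≈ₘ H · A ᵀ
        G≈HAᵀ = cross-lincomb Φ b A (λ j → proj₂ (b-spans (Φ j) (φ∈image j)))

        H≈GCᵀ : H ≈ₘ gram V Φ · C ᵀ
        H≈GCᵀ = cross-lincomb Φ Φ C (λ k → proj₂ (b∈im k))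

        trace-K : trace K ≈ trace (gram V Φ)
        trace-K = trans (trace-comm (A ᵀ) H) (sym (trace-cong G≈HAᵀ))

        GH≈c₀H : ∀ c₀ → GramSquareIs V Φ c₀ → gram V Φ · H ≈ₘ c₀ ⊛ H
        GH≈c₀H c₀ G²≈c₀G = begin
          G · H               ≈⟨ ·-cong ≈ₘ-refl H≈GCᵀ ⟩
          G · (G · C ᵀ)       ≈⟨ ≈ₘ-sym (·-assoc G G (C ᵀ)) ⟩
          G · G · C ᵀ         ≈⟨ ·-cong G²≈c₀G ≈ₘ-refl ⟩
          (c₀ ⊛ G) · C ᵀ      ≈⟨ ⊛-· c₀ G (C ᵀ) ⟩
          c₀ ⊛ (G · C ᵀ)      ≈⟨ (λ j k → *-congˡ (H≈GCᵀ j k)) ⟨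
          c₀ ⊛ H              ∎
          where
          open ≈ₘ-Reasoning
          G : Matrix n n
          G = gram V Φ

        K²≈c₀K : ∀ c₀ → GramSquareIs V Φ c₀ → K · K ≈ₘ c₀ ⊛ K
        K²≈c₀K c₀ G²≈c₀G = begin
          A ᵀ · H · (A ᵀ · H)     ≈⟨ ·-assoc (A ᵀ) H (A ᵀ · H) ⟩
          A ᵀ · (H · (A ᵀ · H))   ≈⟨ ·-cong ≈ₘ-refl (≈ₘ-sym (·-assoc H (A ᵀ) H)) ⟩
          A ᵀ · (H · A ᵀ · H)     ≈⟨ ·-cong ≈ₘ-refl (·-cong (≈ₘ-sym G≈HAᵀ) ≈ₘ-refl) ⟩
          A ᵀ · (gram V Φ · H)    ≈⟨ ·-cong ≈ₘ-refl (GH≈c₀H c₀ G²≈c₀G) ⟩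
          A ᵀ · (c₀ ⊛ H)          ≈⟨ ·-⊛ (A ᵀ) c₀ H ⟩
          c₀ ⊛ K                  ∎
          where open ≈ₘ-Reasoning

        image-orthogonal⇒0 : ∀ {c₀} → IsUnit c₀ → K ≈ₘ c₀ ⊛ 1ₘ →
                             ∀ u → image V Φ u → (∀ j → ⟪ Φ j , u ⟫ ≈ 0#) → u ≋ 0ᵥ
        image-orthogonal⇒0 {c₀} c₀-unit K≈c₀ u u∈im u⊥Φ i =
          trans (sym (bx≋u i)) (lincomb-zero b (λ k → isUnit-cancelˡ c₀-unit (c₀x≈0 k zero)) i)
          where
          open ≈ₘ-Reasoning
          x : Vec d
          x = proj₁ (b-spans u u∈im)
          bx≋u : lincomb b x ≋ u
          bx≋u = proj₂ (b-spans u u∈im)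
          Hx≈0 : H · column x ≈ₘ 0ₘ
          Hx≈0 j _ = trans (sym (form-lincomb (Φ j) b x)) (trans (form-congʳ (Φ j) bx≋u) (u⊥Φ j))
          c₀x≈0 : c₀ ⊛ column x ≈ₘ 0ₘ
          c₀x≈0 = begin
            c₀ ⊛ column x               ≈⟨ (λ k l → *-congˡ (·-identityˡ (column x) k l)) ⟨
            c₀ ⊛ (1ₘ · column x)        ≈⟨ ⊛-· c₀ 1ₘ (column x) ⟨
            (c₀ ⊛ 1ₘ) · column x        ≈⟨ ·-cong (≈ₘ-sym K≈c₀) ≈ₘ-refl ⟩
            A ᵀ · H · column x          ≈⟨ ·-assoc (A ᵀ) H (column x) ⟩
            A ᵀ · (H · column x)        ≈⟨ ·-cong ≈ₘ-refl Hx≈0 ⟩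
            A ᵀ · 0ₘ                    ≈⟨ ·-zeroʳ (A ᵀ) ⟩
            0ₘ                          ∎

theorem5p7 : ∀ {c ℓ : Level} (F : InvolutiveField c ℓ) →
    let open FieldTheory F in
    ∀ {m n : ℕ} (V : NonIsotropicSpace m) (Φ : Fin n → Vec m) (a : Carrier) (d : ℕ) (c₀ : Carrier) →
    (∀ j → NonIsotropicSpace.⟪_,_⟫ V (Φ j) (Φ j) ≈ a) →
    HasDimension V Φ d →
    ¬ (ι d ≈ 0#) →
    c₀ * ι d ≈ ι n * a →
    ¬ (c₀ ≈ 0#) →
    CharGreaterThan d →
    GramSquareIs V Φ c₀ →
    IsNonIsotropic V (image V Φ) × IsTightFrame V Φ c₀ (image V Φ)
theorem5p7 F V Φ a d c₀ ‖φ‖²≈a (b , b∈im , _ , b-spans) _ c₀d≈na c₀≉0 char G²≈c₀G =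
  image-nonIsotropic V Φ orthogonal⇒0 , tightFrame V Φ orthogonal⇒0 c₀ G²≈c₀G
  where
  open FieldTheory F
  open TightFrames F
  open RingLemmas commutativeRing using (IsUnit)
  open Matrices commutativeRing using (_≈ₘ_; _⊛_; 1ₘ)
  open TracelessQuasiIdempotent commutativeRing using (quasiIdempotent⇒scalar)
  open Coordinates V Φ b b∈im b-spans
  c₀-unit : IsUnit c₀
  c₀-unit = field-isUnit c₀≉0
  K≈c₀ : K ≈ₘ c₀ ⊛ 1ₘ
  K≈c₀ = quasiIdempotent⇒scalar K c₀ (K²≈c₀K c₀ G²≈c₀G)
    (trans trace-K (trans (trace-gram V Φ ‖φ‖²≈a) (sym c₀d≈na))) c₀-unit
    (λ k 1≤k k≤d → field-isUnit (char k 1≤k k≤d))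
  orthogonal⇒0 : ∀ u → image V Φ u → (∀ j → NonIsotropicSpace.⟪_,_⟫ V (Φ j) u ≈ 0#) → u ≋ 0ᵥ
  orthogonal⇒0 = image-orthogonal⇒0 c₀-unit K≈c₀
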